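{- Let $(W,R)$ be a frame and $X,Y\subseteq W$. Then: 1. $\emptyset$ and $W$ are propositions. 2. If $X$ and $Y$ are propositions, then $X\cap Y$ is a proposition. 3. $R^\Box(X)$ is a proposition. 4. If $X$ is a proposition, then $X\subseteq R^\Box(-R^\Box(\emptyset)\cup X)$. 5. If $R$ is transitive, then: $X$ is a proposition $\iff R[X]\subseteq X\iff X\subseteq R^\Box(X)$. 6. If $R$ is reflexive, then: $X$ is a proposition $\iff R^\Box(R[X])\subseteq X$. 7. If $R$ is symmetric, then: $X$ is a proposition $\iff R[X]\cap R^\Box(R^\Diamond(X))\subseteq X\iff X\subseteq R^\Box(-R^\Box(R^\Diamond(X))\cup X)$.
   Context: A frame is $(W,R)$ with $W$ nonempty and $R\subseteq W\times W$. For $X\subseteq W$: $-X=W\setminus X$; $R[X]=\{t\in W:\exists s\in X,\ sRt\}$; $R^\Box(X)=\{s\in W:\forall t\in W\,(sRt\Rightarrow t\in X)\}$; $R^\Diamond(X)=-R^\Box(-X)$. A proposition of $(W,R)$ is a set $X\subseteq W$ with $R[X]\cap R^\Box(R[X])\subseteq X$. -}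

module Defs where

open import Level using (0ℓ)
open import Data.Product using (Σ; ∃; _×_)
open import Relation.Binary.Core using (Rel)
open import Relation.Unary using (Pred; ∁; _∩_; _⊆_)

record Frame : Set₁ where
  field
    W     : Set
    R     : Rel W 0ℓ
    point : W

module _ {W : Set} (R : Rel W 0ℓ) where

  image : Pred W 0ℓ → Pred W 0ℓ
  image X t = ∃ λ s → X s × R s t

  box : Pred W 0ℓ → Pred W 0ℓ
  box X s = ∀ t → R s t → X t

  dia : Pred W 0ℓ → Pred W 0ℓ
  dia X = ∁ (box (∁ X))

  IsProposition : Pred W 0ℓ → Set
  IsProposition X = (image X ∩ box (image X)) ⊆ X

{-# OPTIONS --safe #-}
module Submission where

open import Defs
open import Level using (0ℓ)
open import Data.Product using (_×_; _,_; proj₁; proj₂)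
open import Data.Sum using (inj₁; inj₂)
open import Data.Unit using (tt)
open import Relation.Nullary using (yes; no; contradiction)
open import Relation.Nullary.Decidable using (decidable-stable)
open import Function.Bundles using (_⇔_; mk⇔; Equivalence)
open import Axiom.ExcludedMiddle using (ExcludedMiddle)
open import Relation.Unary using (Pred; ∅; U; ∁; _∩_; _∪_; _⊆_)
open import Relation.Binary.Core using (Rel)
open import Relation.Binary.Definitions using (Reflexive; Symmetric; Transitive)

-- R[_] is left adjoint to R^□. Each item follows by comparing R^□(R[X])
-- with a simpler set: R^□(∅) ⊆ R^□(R[X]) always, R^□(R[X]) ⊆ R[X] for reflexive R,
-- R[X] ⊆ R^□(R[X]) for transitive R, and R[X] = R^◇(X) for symmetric R (classically).
-- Items 4 and 7 are then instances of the classical equivalence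
-- R[X] ∩ Z ⊆ X ⇔ X ⊆ R^□(-Z ∪ X).
module FrameProperties {W : Set} (R : Rel W 0ℓ) where

  image-mono : {X Y : Pred W 0ℓ} → X ⊆ Y → image R X ⊆ image R Y
  image-mono X⊆Y (s , xs , sRt) = s , X⊆Y xs , sRt

  box-mono : {X Y : Pred W 0ℓ} → X ⊆ Y → box R X ⊆ box R Y
  box-mono X⊆Y □X t sRt = X⊆Y (□X t sRt)

  image⊆⇔⊆box : {X Y : Pred W 0ℓ} → (image R X ⊆ Y) ⇔ (X ⊆ box R Y)
  image⊆⇔⊆box {X} {Y} = mk⇔ to from
    where
    to : image R X ⊆ Y → X ⊆ box R Y
    to h xs t sRt = h (_ , xs , sRt)

    from : X ⊆ box R Y → image R X ⊆ Y
    from h (_ , xs , sRt) = h xs _ sRt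

  image-box⊆ : {X : Pred W 0ℓ} → image R (box R X) ⊆ X
  image-box⊆ = Equivalence.from image⊆⇔⊆box (λ □X → □X)

  box⊆ : Reflexive R → {X : Pred W 0ℓ} → box R X ⊆ X
  box⊆ refl □X = □X _ refl

  image-⊆-box-image : Transitive R → {X : Pred W 0ℓ} → image R X ⊆ box R (image R X)
  image-⊆-box-image trans (s , xs , sRt) u tRu = s , xs , trans sRt tRu

  image⊆dia : Symmetric R → {X : Pred W 0ℓ} → image R X ⊆ dia R X
  image⊆dia sym (s , xs , sRt) □∁X = □∁X s (sym sRt) xs

  dia⊆image : ExcludedMiddle 0ℓ → Symmetric R → {X : Pred W 0ℓ} → dia R X ⊆ image R X
  dia⊆image em sym ◇X =
    decidable-stable em λ ∉image → ◇X λ s tRs xs → ∉image (s , xs , sym tRs)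

  ∅-isProposition : IsProposition R ∅
  ∅-isProposition ((_ , () , _) , _)

  U-isProposition : IsProposition R U
  U-isProposition _ = tt

  image⊆⇒isProposition : {X : Pred W 0ℓ} → image R X ⊆ X → IsProposition R X
  image⊆⇒isProposition h (i , _) = h i

  box-image⊆⇒isProposition : {X : Pred W 0ℓ} → box R (image R X) ⊆ X → IsProposition R X
  box-image⊆⇒isProposition h (_ , b) = h b

  isProposition⇒image⊆ : Transitive R → {X : Pred W 0ℓ} →
                         IsProposition R X → image R X ⊆ X
  isProposition⇒image⊆ trans p i = p (i , image-⊆-box-image trans i)

  isProposition⇒box-image⊆ : Reflexive R → {X : Pred W 0ℓ} →
                             IsProposition R X → box R (image R X) ⊆ X
  isProposition⇒box-image⊆ refl p b = p (box⊆ refl b , b)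

  isProposition-weaken : {X Z : Pred W 0ℓ} → Z ⊆ box R (image R X) →
                         IsProposition R X → (image R X ∩ Z) ⊆ X
  isProposition-weaken Z⊆ p (i , z) = p (i , Z⊆ z)

  isProposition-strengthen : {X Z : Pred W 0ℓ} → box R (image R X) ⊆ Z →
                             (image R X ∩ Z) ⊆ X → IsProposition R X
  isProposition-strengthen ⊆Z h (i , b) = h (i , ⊆Z b)

  ∩-isProposition : {X Y : Pred W 0ℓ} →
                    IsProposition R X → IsProposition R Y → IsProposition R (X ∩ Y)
  ∩-isProposition pX pY (i , b) =
      pX (image-mono proj₁ i , box-mono (image-mono proj₁) b)
    , pY (image-mono proj₂ i , box-mono (image-mono proj₂) b)

  box-isProposition : {X : Pred W 0ℓ} → IsProposition R (box R X)
  box-isProposition (_ , b) = box-mono image-box⊆ b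

  image∩⊆⇔⊆box-∁∪ : ExcludedMiddle 0ℓ → {X Z : Pred W 0ℓ} →
                    ((image R X ∩ Z) ⊆ X) ⇔ (X ⊆ box R (∁ Z ∪ X))
  image∩⊆⇔⊆box-∁∪ em {X} {Z} = mk⇔ to from
    where
    to : (image R X ∩ Z) ⊆ X → X ⊆ box R (∁ Z ∪ X)
    to h xs t sRt with em {Z t}
    ... | yes z = inj₂ (h ((_ , xs , sRt) , z))
    ... | no ¬z = inj₁ ¬z

    from : X ⊆ box R (∁ Z ∪ X) → (image R X ∩ Z) ⊆ X
    from h ((_ , xs , sRt) , z) with h xs _ sRt
    ... | inj₁ ¬z = contradiction z ¬z
    ... | inj₂ xt = xt

open FrameProperties

lemma4 : ExcludedMiddle 0ℓ → (F : Frame) → (X Y : Pred (Frame.W F) 0ℓ) →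
    (IsProposition (Frame.R F) ∅ × IsProposition (Frame.R F) U)
    × (IsProposition (Frame.R F) X → IsProposition (Frame.R F) Y → IsProposition (Frame.R F) (X ∩ Y))
    × IsProposition (Frame.R F) (box (Frame.R F) X)
    × (IsProposition (Frame.R F) X → X ⊆ box (Frame.R F) (∁ (box (Frame.R F) ∅) ∪ X))
    × (Transitive (Frame.R F) →
        (IsProposition (Frame.R F) X ⇔ (image (Frame.R F) X ⊆ X))
        × ((image (Frame.R F) X ⊆ X) ⇔ (X ⊆ box (Frame.R F) X)))
    × (Reflexive (Frame.R F) →
        IsProposition (Frame.R F) X ⇔ (box (Frame.R F) (image (Frame.R F) X) ⊆ X))
    × (Symmetric (Frame.R F) →
        (IsProposition (Frame.R F) X
          ⇔ ((image (Frame.R F) X ∩ box (Frame.R F) (dia (Frame.R F) X)) ⊆ X))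
        × (((image (Frame.R F) X ∩ box (Frame.R F) (dia (Frame.R F) X)) ⊆ X)
          ⇔ (X ⊆ box (Frame.R F) (∁ (box (Frame.R F) (dia (Frame.R F) X)) ∪ X))))
lemma4 em F X Y =
    (∅-isProposition R , U-isProposition R)
  , ∩-isProposition R
  , box-isProposition R
  , (λ p → Equivalence.to (image∩⊆⇔⊆box-∁∪ R em)
             (isProposition-weaken R (box-mono R λ ()) p))
  , (λ trans → mk⇔ (isProposition⇒image⊆ R trans) (image⊆⇒isProposition R)
             , image⊆⇔⊆box R)
  , (λ refl → mk⇔ (isProposition⇒box-image⊆ R refl) (box-image⊆⇒isProposition R))
  , (λ sym → mk⇔ (isProposition-weaken R (box-mono R (dia⊆image R em sym)))
                 (isProposition-strengthen R (box-mono R (image⊆dia R sym)))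
           , image∩⊆⇔⊆box-∁∪ R em)
  where open Frame F
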